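{- Let $\lambda$ be a partition with distinct parts and let $T^*$ be a minimal bar tableau of shape $\lambda$ such that no bar boundary lies an even number of squares along any row (i.e. for every row $i$ and every $1\le k<\lambda_i$, if the $k$-th and $(k+1)$-st squares of row $i$ carry different labels then $k$ is odd). Then every row of odd length is labelled entirely by a single label, and every row of even length is either labelled entirely by a single label or contains exactly two distinct labels, each occurring an odd number of times in that row.
   Context: For a partition $\lambda$ with distinct parts of length $\ell$, the shifted diagram $S(\lambda)$ has $\ell$ rows, row $i$ consisting of $\lambda_i$ squares, the first square of row $i$ (for $i>1$) placed under the second square of row $i-1$. For an odd positive integer $r$ (put $\lambda_{\ell+1}=0$), the $r$-bars of $\lambda$ are: (type 1) for a row $i$ such that $\lambda_{j+1}<\lambda_i-r<\lambda_j$ for some $j\le \ell$, the rightmost $r$ squares of row $i$; removing them gives the strict partition obtained by deleting $\lambda_i$ and inserting $\lambda_i-r$ in its sorted position; (type 2) for a row $i$ with $\lambda_i=r$, the whole row $i$; removing it deletes the part $\lambda_i$; (type 3) for rows $i<j$ with $\lambda_i+\lambda_j=r$, all squares of rows $i$ and $j$; removing it deletes both parts. A bar tableau of shape $\lambda$ is an assignment of positive integers to the squares of $S(\lambda)$ such that either $\lambda$ is empty, or the set of squares carrying the largest integer is an $r$-bar (for some odd $r$) and, after removing this bar and reordering the remaining rows so that they form the shifted diagram of the resulting strict partition (a shortened row keeping its remaining leftmost entries), the result is a bar tableau. Each label occupies exactly one bar; the number of bars is the number of distinct labels. A bar tableau of shape $\lambda$ is minimal if no bar tableau of shape $\lambda$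 has fewer bars. -}

module Defs where

open import Data.Nat using (ℕ; zero; suc; _+_; _*_; _<_; _≤_; _<ᵇ_; _≟_)
open import Data.Bool using (if_then_else_)
open import Data.List using (List; []; _∷_; _++_; map; length; replicate; concat; deduplicate; filter)
open import Data.List.Relation.Unary.All using (All)
open import Data.List.Membership.Propositional using (_∈_; _∉_)
open import Data.Product using (∃; _×_)
open import Relation.Binary.PropositionalEquality using (_≡_; _≢_)

-- A (shifted) tableau is a list of rows (top to bottom), each row the list
-- of labels of its squares from left to right.
Tableau : Set
Tableau = List (List ℕ)

shape : Tableau → List ℕ
shape = map length

Odd : ℕ → Set
Odd n = ∃ λ k → n ≡ suc (2 * k)

data StrictPartition : List ℕ → Set where
  sp-nil  : StrictPartition []
  sp-one  : ∀ {a} → 0 < a → StrictPartition (a ∷ [])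
  sp-cons : ∀ {a b l} → b < a → StrictPartition (b ∷ l) → StrictPartition (a ∷ b ∷ l)

insertRow : List ℕ → Tableau → Tableau
insertRow u [] = u ∷ []
insertRow u (v ∷ vs) = if length v <ᵇ length u then u ∷ v ∷ vs else v ∷ insertRow u vs

NoLabel : ℕ → Tableau → Set
NoLabel m T = All (All (λ x → x ≢ m)) T

-- RemoveBar m T T' : the squares of T carrying label m form an r-bar (r odd)
-- and T' is the tableau obtained by removing it and reordering the rows.
data RemoveBar (m : ℕ) : Tableau → Tableau → Set where
  type1 : ∀ (A B : Tableau) (u : List ℕ) (r : ℕ) → Odd r → 0 < length u →
          length u ∉ shape (A ++ B) → All (λ x → x ≢ m) u → NoLabel m (A ++ B) →
          RemoveBar m (A ++ (u ++ replicate r m) ∷ B) (insertRow u (A ++ B))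
  type2 : ∀ (A B : Tableau) (r : ℕ) → Odd r → NoLabel m (A ++ B) →
          RemoveBar m (A ++ replicate r m ∷ B) (A ++ B)
  type3 : ∀ (A B C : Tableau) (p q : ℕ) → Odd (p + q) → NoLabel m (A ++ B ++ C) →
          RemoveBar m (A ++ replicate p m ∷ B ++ replicate q m ∷ C) (A ++ B ++ C)

data BarTableau : Tableau → Set where
  bt-empty : BarTableau []
  bt-step  : ∀ {T T'} (m : ℕ) → StrictPartition (shape T) →
             All (All (λ x → 1 ≤ x × x ≤ m)) T →
             RemoveBar m T T' → BarTableau T' → BarTableau T

-- number of bars = number of distinct labels
numBars : Tableau → ℕ
numBars T = length (deduplicate _≟_ (concat T))

MinimalBarTableau : List ℕ → Tableau → Set
MinimalBarTableau λ′ T =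
  BarTableau T × shape T ≡ λ′ ×
  (∀ (T' : Tableau) → BarTableau T' → shape T' ≡ λ′ → numBars T ≤ numBars T')

count : ℕ → List ℕ → ℕ
count a row = length (filter (λ x → x ≟ a) row)

OddBoundaries : Tableau → Set
OddBoundaries T = ∀ (row : List ℕ) → row ∈ T → ∀ (u v : List ℕ) (a b : ℕ) →
  row ≡ u ++ a ∷ b ∷ v → a ≢ b → Odd (suc (length u))

{-# OPTIONS --safe #-}
-- Reading the bar-removal process backwards, every row of a bar tableau is a
-- constant block (possibly empty) followed by blocks of odd length, each with a
-- label that does not occur earlier in the row. If every change of label happens
-- after an odd number of squares, the first block must be odd, and a second
-- change would then happen after odd + odd squares. So the row is constant, or
-- consists of two odd blocks with distinct labels.
module Submission where

open import Defs
open import Data.Nat using (ℕ; zero; suc; _+_; _*_; _≟_; _<ᵇ_)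
open import Data.Nat.Properties using (suc-injective; +-suc; +-identityʳ; *-distribˡ-+; even≢odd)
open import Data.List using (List; []; _∷_; _++_; length; replicate; filter)
open import Data.List.Properties using (++-assoc; length-++; length-replicate; filter-++; filter-all; filter-none)
open import Data.List.Relation.Unary.All using (All; []; _∷_; lookup)
open import Data.List.Relation.Unary.All.Properties using (++⁺; ++⁻; replicate⁺; replicate⁻)
open import Data.List.Relation.Binary.Permutation.Propositional using (_↭_; refl; prep; swap; trans; ↭-sym)
open import Data.List.Relation.Binary.Permutation.Propositional.Properties using (All-resp-↭; shift)
open import Data.List.Membership.Propositional using (_∈_)
open import Data.Product using (∃; ∃₂; _×_; _,_; proj₂)
open import Data.Sum using (_⊎_; inj₁; inj₂)
open import Data.Bool using (true; false)
open import Data.Empty using (⊥-elim)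
open import Relation.Nullary using (¬_)
open import Relation.Binary.PropositionalEquality using (_≡_; _≢_; refl; sym; cong; subst; module ≡-Reasoning)

odd+odd-not-odd : ∀ {m n} → Odd m → Odd n → ¬ Odd (m + n)
odd+odd-not-odd (i , refl) (j , refl) (k , eq) = even≢odd k (i + j) (begin
  2 * k                     ≡⟨ sym (suc-injective eq) ⟩
  2 * i + suc (2 * j)       ≡⟨ +-suc (2 * i) (2 * j) ⟩
  suc (2 * i + 2 * j)       ≡⟨ cong suc (sym (*-distribˡ-+ 2 i j)) ⟩
  suc (2 * (i + j))         ∎)
  where open ≡-Reasoning

replicate-suc-++ : ∀ {A : Set} n (a : A) w → replicate (suc n) a ++ w ≡ replicate n a ++ a ∷ w
replicate-suc-++ zero    a w = refl
replicate-suc-++ (suc n) a w = cong (a ∷_) (replicate-suc-++ n a w)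

count-++ : ∀ a (xs ys : List ℕ) → count a (xs ++ ys) ≡ count a xs + count a ys
count-++ a xs ys = begin
  length (filter (_≟ a) (xs ++ ys))                      ≡⟨ cong length (filter-++ (_≟ a) xs ys) ⟩
  length (filter (_≟ a) xs ++ filter (_≟ a) ys)          ≡⟨ length-++ (filter (_≟ a) xs) ⟩
  count a xs + count a ys                                ∎
  where open ≡-Reasoning

count-replicate-≡ : ∀ a p → count a (replicate p a) ≡ p
count-replicate-≡ a p =
  subst (λ xs → length xs ≡ p) (sym (filter-all (_≟ a) (replicate⁺ p refl))) (length-replicate p)

count-replicate-≢ : ∀ {a b} p → b ≢ a → count a (replicate p b) ≡ 0
count-replicate-≢ {a} p b≢a = cong length (filter-none (_≟ a) (replicate⁺ p b≢a))

insertRow-↭ : ∀ u L → insertRow u L ↭ u ∷ L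
insertRow-↭ u []       = refl
insertRow-↭ u (v ∷ vs) with length v <ᵇ length u
... | true  = refl
... | false = trans (prep v (insertRow-↭ u vs)) (swap v u refl)

All-insert : ∀ {A : Set} {P : A → Set} xs ys {x} → All P (xs ++ ys) → P x → All P (xs ++ x ∷ ys)
All-insert xs ys {x} p-xs++ys px = All-resp-↭ (↭-sym (shift x xs ys)) (px ∷ p-xs++ys)

data BarRow : List ℕ → Set where
  block  : ∀ p a → BarRow (replicate p a)
  extend : ∀ {u r m} → BarRow u → Odd r → All (_≢ m) u → BarRow (u ++ replicate r m)

barTableau-rows : ∀ {T} → BarTableau T → All BarRow T
barTableau-rows bt-empty = []
barTableau-rows (bt-step m _ _ (type1 A B u r r-odd _ _ u∌m _) bt)
  with All-resp-↭ (insertRow-↭ u (A ++ B)) (barTableau-rows bt)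
... | bar-u ∷ bar-AB = All-insert A B bar-AB (extend bar-u r-odd u∌m)
barTableau-rows (bt-step m _ _ (type2 A B r _ _) bt) =
  All-insert A B (barTableau-rows bt) (block r m)
barTableau-rows (bt-step m _ _ (type3 A B C p q _ _) bt)
  with ++⁻ A (barTableau-rows bt)
... | bar-A , bar-BC = All-insert A _ (++⁺ bar-A (All-insert B C bar-BC (block q m))) (block p m)

RowOddBoundaries : List ℕ → Set
RowOddBoundaries row = ∀ (u v : List ℕ) (a b : ℕ) →
  row ≡ u ++ a ∷ b ∷ v → a ≢ b → Odd (suc (length u))

rowOddBoundaries-prefix : ∀ u w → RowOddBoundaries (u ++ w) → RowOddBoundaries u
rowOddBoundaries-prefix u w odd-uw u₁ v a b refl =
  odd-uw u₁ (v ++ w) a b (++-assoc u₁ (a ∷ b ∷ v) w)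

rowOddBoundaries-block-end : ∀ u n w {a b} →
  RowOddBoundaries (u ++ replicate (suc n) a ++ b ∷ w) → a ≢ b → Odd (length u + suc n)
rowOddBoundaries-block-end u n w {a} {b} odd-row a≢b =
  subst Odd length-eq (odd-row (u ++ replicate n a) w a b row-eq a≢b)
  where
    open ≡-Reasoning
    row-eq : u ++ replicate (suc n) a ++ b ∷ w ≡ (u ++ replicate n a) ++ a ∷ b ∷ w
    row-eq = begin
      u ++ replicate (suc n) a ++ b ∷ w   ≡⟨ cong (u ++_) (replicate-suc-++ n a (b ∷ w)) ⟩
      u ++ replicate n a ++ a ∷ b ∷ w     ≡⟨ ++-assoc u (replicate n a) (a ∷ b ∷ w) ⟨
      (u ++ replicate n a) ++ a ∷ b ∷ w   ∎
    length-eq : suc (length (u ++ replicate n a)) ≡ length u + suc n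
    length-eq = begin
      suc (length (u ++ replicate n a))        ≡⟨ cong suc (length-++ u) ⟩
      suc (length u + length (replicate n a))  ≡⟨ cong (λ k → suc (length u + k)) (length-replicate n) ⟩
      suc (length u + n)                       ≡⟨ +-suc (length u) n ⟨
      length u + suc n                         ∎

data ConstantOrTwoOddBlocks : List ℕ → Set where
  constant : ∀ p a → ConstantOrTwoOddBlocks (replicate p a)
  twoOdd   : ∀ {p q a b} → a ≢ b → Odd p → Odd q →
             ConstantOrTwoOddBlocks (replicate p a ++ replicate q b)

barRow-oddBoundaries : ∀ {row} → BarRow row → RowOddBoundaries row → ConstantOrTwoOddBlocks row
barRow-oddBoundaries (block p a) _ = constant p a
barRow-oddBoundaries (extend {u} {r} {m} bar-u r-odd u∌m) odd-row
  with barRow-oddBoundaries bar-u (rowOddBoundaries-prefix u (replicate r m) odd-row) | r-odd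
... | constant zero    a | _ = constant r m
... | constant (suc n) a | k , refl =
  twoOdd a≢m (rowOddBoundaries-block-end [] n (replicate (2 * k) m) odd-row a≢m) r-odd
  where
    a≢m : a ≢ m
    a≢m = replicate⁻ u∌m
... | twoOdd {q = zero} _ _ (_ , ()) | _
... | twoOdd {p} {suc q} {a} {b} a≢b p-odd q-odd | k , refl =
  ⊥-elim (odd+odd-not-odd p-odd q-odd (subst Odd (cong (_+ suc q) (length-replicate p)) boundary))
  where
    b≢m : b ≢ m
    b≢m = replicate⁻ (proj₂ (++⁻ (replicate p a) u∌m))
    boundary : Odd (length (replicate p a) + suc q)
    boundary = rowOddBoundaries-block-end (replicate p a) q (replicate (2 * k) m)
      (subst RowOddBoundaries (++-assoc (replicate p a) (replicate (suc q) b) _) odd-row) b≢m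

Constant : List ℕ → Set
Constant row = ∃ λ a → All (_≡ a) row

TwoOddLabels : List ℕ → Set
TwoOddLabels row =
  ∃₂ λ a b → a ≢ b × All (λ x → x ≡ a ⊎ x ≡ b) row × Odd (count a row) × Odd (count b row)

constantOrTwoOddBlocks-odd : ∀ {row} → ConstantOrTwoOddBlocks row → Odd (length row) → Constant row
constantOrTwoOddBlocks-odd (constant p a) _ = a , replicate⁺ p refl
constantOrTwoOddBlocks-odd (twoOdd {p} {q} {a} {b} _ p-odd q-odd) row-odd =
  ⊥-elim (odd+odd-not-odd p-odd q-odd (subst Odd length-eq row-odd))
  where
    open ≡-Reasoning
    length-eq : length (replicate p a ++ replicate q b) ≡ p + q
    length-eq = begin
      length (replicate p a ++ replicate q b)            ≡⟨ length-++ (replicate p a) ⟩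
      length (replicate p a) + length (replicate q b)    ≡⟨ cong (_+ length (replicate q b)) (length-replicate p) ⟩
      p + length (replicate q b)                         ≡⟨ cong (p +_) (length-replicate q) ⟩
      p + q                                              ∎

twoOddBlocks-twoOddLabels : ∀ {p q a b} → a ≢ b → Odd p → Odd q →
  TwoOddLabels (replicate p a ++ replicate q b)
twoOddBlocks-twoOddLabels {p} {q} {a} {b} a≢b p-odd q-odd =
  a , b , a≢b , ++⁺ (replicate⁺ p (inj₁ refl)) (replicate⁺ q (inj₂ refl)) ,
  subst Odd (sym count-a) p-odd , subst Odd (sym count-b) q-odd
  where
    open ≡-Reasoning
    count-a : count a (replicate p a ++ replicate q b) ≡ p
    count-a = begin
      count a (replicate p a ++ replicate q b)            ≡⟨ count-++ a (replicate p a) _ ⟩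
      count a (replicate p a) + count a (replicate q b)   ≡⟨ cong (_+ count a (replicate q b)) (count-replicate-≡ a p) ⟩
      p + count a (replicate q b)                         ≡⟨ cong (p +_) (count-replicate-≢ q (λ b≡a → a≢b (sym b≡a))) ⟩
      p + 0                                               ≡⟨ +-identityʳ p ⟩
      p                                                   ∎
    count-b : count b (replicate p a ++ replicate q b) ≡ q
    count-b = begin
      count b (replicate p a ++ replicate q b)            ≡⟨ count-++ b (replicate p a) _ ⟩
      count b (replicate p a) + count b (replicate q b)   ≡⟨ cong (_+ count b (replicate q b)) (count-replicate-≢ p a≢b) ⟩
      count b (replicate q b)                             ≡⟨ count-replicate-≡ b q ⟩
      q                                                   ∎

constantOrTwoOddBlocks-even : ∀ {row} → ConstantOrTwoOddBlocks row → Constant row ⊎ TwoOddLabels row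
constantOrTwoOddBlocks-even (constant p a)          = inj₁ (a , replicate⁺ p refl)
constantOrTwoOddBlocks-even (twoOdd a≢b p-odd q-odd) = inj₂ (twoOddBlocks-twoOddLabels a≢b p-odd q-odd)

mainTheorem3 : ∀ (λ′ : List ℕ) (T : Tableau) → StrictPartition λ′ →
    MinimalBarTableau λ′ T → OddBoundaries T →
    ∀ (row : List ℕ) → row ∈ T →
      (Odd (length row) → ∃ λ a → All (λ x → x ≡ a) row) ×
      (¬ Odd (length row) →
        (∃ λ a → All (λ x → x ≡ a) row) ⊎
        (∃₂ λ a b → a ≢ b × All (λ x → x ≡ a ⊎ x ≡ b) row × Odd (count a row) × Odd (count b row)))
mainTheorem3 _ _ _ (bar-T , _) odd-T row row∈T =
  constantOrTwoOddBlocks-odd blocks , λ _ → constantOrTwoOddBlocks-even blocks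
  where
    blocks : ConstantOrTwoOddBlocks row
    blocks = barRow-oddBoundaries (lookup (barTableau-rows bar-T) row∈T) (odd-T row row∈T)
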